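{- Let $\mathcal M=(U,\mathcal I)$ be a matroid with weight function $w:U\to\mathbb R$. (i) For $j\in[1,\beta]$ let $B^\ast_j$ be a basis of the matroid $\mathcal M^\ast_j$. Then $B^\ast_1\cup B^\ast_2\cup\dots\cup B^\ast_\beta$ is a minimum basis of $\mathcal M$. (ii) For any minimum basis $B^\ast$ of $\mathcal M$ and every $j\in[1,\beta]$, $B^\ast\cap U^\ast_j$ is a basis of $\mathcal M^\ast_j$.
   Context: $w(S)=\sum_{x\in S}w(x)$; a minimum basis is a basis of minimum weight, and $\mathcal B^\ast$ is the set of minimum bases. All minimum bases have the same multiset of weights; let $\omega_1<\omega_2<\dots<\omega_\beta$ be the distinct weights of elements of a minimum basis. $U^\ast$ is the set of elements contained in some minimum basis. For $j\in[1,\beta]$, $U^\ast_j=\{e\in U^\ast: w(e)=\omega_j\}$ and $\mathcal M^\ast_j=(U^\ast_j,\mathcal I^\ast_j)$ with $\mathcal I^\ast_j=\{S\subseteq U^\ast_j:\ S\subseteq B\text{ for some }B\in\mathcal B^\ast\}$; $\mathcal M^\ast_j$ is a matroid. -}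

module Defs where

open import Level using (0ℓ)
open import Data.Nat using (ℕ; zero; suc) renaming (_<_ to _<ℕ_)
open import Data.Fin using (Fin; zero; suc) renaming (_<_ to _<ᶠ_)
open import Data.Fin.Subset using (Subset; _∈_; _∉_; _⊆_; _∪_; ⁅_⁆; ∣_∣; ⋃; inside; outside)
  renaming (⊥ to ∅)
open import Data.List using (List)
import Data.List as List
open import Data.Vec using ([]; _∷_)
open import Data.Product using (Σ; ∃; _×_; _,_)
open import Relation.Binary.PropositionalEquality using (_≡_; _≢_)
open import Algebra.Structures using (IsAbelianGroup)
open import Relation.Binary.Structures using (IsTotalOrder)

record Matroid (n : ℕ) : Set₁ where
  field
    Indep     : Subset n → Set
    indep-∅   : Indep ∅
    indep-⊆   : ∀ {A B} → B ⊆ A → Indep A → Indep B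
    exchange  : ∀ {A B} → Indep A → Indep B → ∣ A ∣ <ℕ ∣ B ∣ →
                ∃ λ x → x ∈ B × x ∉ A × Indep (A ∪ ⁅ x ⁆)

-- Weight values: a totally ordered abelian group (ℝ with + and ≤ is an instance).
record OrderedAbelianGroup : Set₁ where
  infixl 6 _+_
  infix 4 _≤_
  field
    Carrier        : Set
    _+_            : Carrier → Carrier → Carrier
    0#             : Carrier
    -_             : Carrier → Carrier
    _≤_            : Carrier → Carrier → Set
    isAbelianGroup : IsAbelianGroup _≡_ _+_ 0# -_
    isTotalOrder   : IsTotalOrder _≡_ _≤_
    +-monoˡ-≤      : ∀ {a b} c → a ≤ b → a + c ≤ b + c

  _<_ : Carrier → Carrier → Set
  a < b = a ≤ b × a ≢ b

IsBasisOf : ∀ {n} → (Subset n → Set) → Subset n → Set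
IsBasisOf Indep B = Indep B × (∀ A → Indep A → B ⊆ A → A ⊆ B)

⋃[_] : ∀ {n β} → (Fin β → Subset n) → Subset n
⋃[ F ] = ⋃ (List.tabulate F)

module Weighted (G : OrderedAbelianGroup) {n : ℕ} (M : Matroid n)
                (w : Fin n → OrderedAbelianGroup.Carrier G) where
  open OrderedAbelianGroup G
  open Matroid M

  sumOver : ∀ {m} → (Fin m → Carrier) → Subset m → Carrier
  sumOver f []             = 0#
  sumOver f (inside  ∷ p)  = f zero + sumOver (λ i → f (suc i)) p
  sumOver f (outside ∷ p)  = sumOver (λ i → f (suc i)) p

  weight : Subset n → Carrier
  weight = sumOver w

  IsBasis : Subset n → Set
  IsBasis = IsBasisOf Indep

  IsMinBasis : Subset n → Set
  IsMinBasis B = IsBasis B × (∀ B′ → IsBasis B′ → weight B ≤ weight B′)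

  InU* : Fin n → Set
  InU* e = ∃ λ B → IsMinBasis B × e ∈ B

  IsMinBasisWeight : Carrier → Set
  IsMinBasisWeight c = ∃ λ B → IsMinBasis B × ∃ λ e → e ∈ B × w e ≡ c

  InU*[_] : Carrier → Fin n → Set
  InU*[ ω ] e = InU* e × w e ≡ ω

  -- Independent sets of M*_ω : S ⊆ U*_ω and S ⊆ B for some minimum basis B
  Indep*[_] : Carrier → Subset n → Set
  Indep*[ ω ] S = (∀ e → e ∈ S → InU*[ ω ] e) × ∃ λ B → IsMinBasis B × S ⊆ B

  DistinctMinWeights : (β : ℕ) → (Fin β → Carrier) → Set
  DistinctMinWeights β ω =
    (∀ j → IsMinBasisWeight (ω j)) ×
    (∀ c → IsMinBasisWeight c → ∃ λ j → ω j ≡ c) ×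
    (∀ i j → i <ᶠ j → ω i < ω j)

{-# OPTIONS --safe #-}
module Submission where

-- If B is a minimum basis, no independent set whose elements are all lighter than ω_k is larger
-- than the part of B lighter than ω_k: otherwise an element of it could be exchanged into B for a
-- heavier one.  Hence all minimum bases have equally many elements below each ω_k, and so in each
-- layer U*_j; this gives (ii).  For minimum bases D and C the same count shows that
-- D_{<k} ∪ C_{≥k} is a basis, and as the weights of D_{<k} ∪ C_{≥k} and C_{<k} ∪ D_{≥k} add up to
-- w(D) + w(C), both are minimum.  Every basis B*_j of M*_j is the layer ω_j of some minimum basis,
-- so replacing the layers of a minimum basis one by one by B*_1, …, B*_β keeps it minimum: (i).

open import Defs

open import Level using (Level; 0ℓ)
open import Data.Nat using (ℕ; zero; suc; _+_; _≤_; _<_; _≟_; _≤?_; _<?_; z≤n; s≤s)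
open import Data.Nat.Properties
  using (+-suc; +-comm; +-cancelˡ-≡; +-cancelˡ-≤; +-monoˡ-≤; ≤-refl; ≤-reflexive; ≤-trans; ≤-antisym;
         <⇒≤; <⇒≱; ≰⇒>; ≮⇒≥; ≤-<-trans; <-≤-trans; m<n⇒m<1+n; m<1+n⇒m<n∨m≡n;
         ≤-totalOrder; module ≤-Reasoning)
open import Data.Fin using (Fin; zero; suc; toℕ)
open import Data.Fin.Properties using (¬Fin0; <-cmp; toℕ-injective; toℕ<n; toℕ-fromℕ<)
open import Data.Fin.Subset
  using (Subset; _∈_; _∉_; _⊆_; _⊃_; _∪_; _∩_; _─_; ⁅_⁆; ∣_∣; ⋃; inside; outside; Empty)
  renaming (⊥ to ∅)
open import Data.Fin.Subset.Properties
open import Data.Fin.Subset.Induction using (⊃-wellFounded; Acc; acc)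
open import Data.Vec using ([]; _∷_; here; there; tabulate)
open import Data.Vec.Properties using (lookup∘tabulate; []=⇒lookup; lookup⇒[]=)
open import Data.List using (List)
import Data.List as List
import Data.List.Extrema
open import Data.List.Relation.Unary.Any using (Any; here; there)
import Data.List.Relation.Unary.Any.Properties as Any
import Data.List.Relation.Unary.All as All
open import Data.List.Relation.Unary.All.Properties using (all-filter)
open import Data.List.Membership.Propositional using () renaming (_∈_ to _∈ˡ_)
open import Data.List.Membership.Propositional.Properties using (∈-map⁺; ∈-++⁺ˡ; ∈-++⁺ʳ; ∈-filter⁺)
open import Data.Product using (Σ; ∃; _×_; _,_; proj₁; proj₂)
open import Data.Sum using (_⊎_; inj₁; inj₂; [_,_]′)
open import Data.Sum.Function.Propositional using (_⊎-⇔_)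
open import Data.Bool using (true)
open import Function using (_∘_; id; _⇔_; mk⇔; Equivalence)
open import Function.Construct.Identity using (⇔-id)
open import Function.Properties.Equivalence using (⇔-setoid)
open import Relation.Nullary using (¬_; yes; no; does; contradiction)
open import Relation.Nullary.Negation using (¬¬-map)
open import Relation.Nullary.Decidable using (_×-dec_; ¬¬-excluded-middle; dec-true)
import Relation.Nullary.Decidable as Dec
open import Relation.Unary using (Pred; Decidable)
open import Relation.Binary.Definitions using (tri<; tri≈; tri>)
open import Relation.Binary.Bundles using (TotalOrder)
open import Relation.Binary.Structures using (IsTotalOrder)
open import Relation.Binary.PropositionalEquality
  using (_≡_; refl; sym; trans; cong; cong₂; subst; subst₂; module ≡-Reasoning)
import Relation.Binary.Reasoning.PartialOrder
import Relation.Binary.Reasoning.Setoid as SetoidReasoning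
open import Algebra.Bundles using (CommutativeSemigroup)
open import Algebra.Structures using (IsAbelianGroup)
import Algebra.Properties.CommutativeSemigroup

module ℕ-Extrema = Data.List.Extrema ≤-totalOrder

private
  variable
    n : ℕ
    p q : Subset n
    x : Fin n
    ℓ : Level

Disjoint : Subset n → Subset n → Set
Disjoint p q = ∀ {x} → x ∈ p → x ∉ q

x∈p─q⇒x∉q : ∀ (p q : Subset n) → x ∈ p ─ q → x ∉ q
x∈p─q⇒x∉q (inside ∷ p) (outside ∷ q) here          ()
x∈p─q⇒x∉q (_      ∷ p) (_       ∷ q) (there x∈p─q) (there x∈q) = x∈p─q⇒x∉q p q x∈p─q x∈q

∣p∪q∣≡∣p∣+∣q∣ : ∀ (p q : Subset n) → Disjoint p q → ∣ p ∪ q ∣ ≡ ∣ p ∣ + ∣ q ∣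
∣p∪q∣≡∣p∣+∣q∣ []            []            _ = refl
∣p∪q∣≡∣p∣+∣q∣ (inside  ∷ p) (inside  ∷ q) d = contradiction here (d here)
∣p∪q∣≡∣p∣+∣q∣ (inside  ∷ p) (outside ∷ q) d = cong suc (∣p∪q∣≡∣p∣+∣q∣ p q (λ x∈p → d (there x∈p) ∘ there))
∣p∪q∣≡∣p∣+∣q∣ (outside ∷ p) (inside  ∷ q) d =
  trans (cong suc (∣p∪q∣≡∣p∣+∣q∣ p q (λ x∈p → d (there x∈p) ∘ there))) (sym (+-suc ∣ p ∣ ∣ q ∣))
∣p∪q∣≡∣p∣+∣q∣ (outside ∷ p) (outside ∷ q) d = ∣p∪q∣≡∣p∣+∣q∣ p q (λ x∈p → d (there x∈p) ∘ there)

p∩q∪p─q≡p : ∀ (p q : Subset n) → (p ∩ q) ∪ (p ─ q) ≡ p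
p∩q∪p─q≡p []            []            = refl
p∩q∪p─q≡p (inside  ∷ p) (inside  ∷ q) = cong (inside ∷_) (p∩q∪p─q≡p p q)
p∩q∪p─q≡p (inside  ∷ p) (outside ∷ q) = cong (inside ∷_) (p∩q∪p─q≡p p q)
p∩q∪p─q≡p (outside ∷ p) (inside  ∷ q) = cong (outside ∷_) (p∩q∪p─q≡p p q)
p∩q∪p─q≡p (outside ∷ p) (outside ∷ q) = cong (outside ∷_) (p∩q∪p─q≡p p q)

p∩q-disjoint-p─q : ∀ (p q : Subset n) → Disjoint (p ∩ q) (p ─ q)
p∩q-disjoint-p─q p q x∈p∩q x∈p─q = x∈p─q⇒x∉q p q x∈p─q (proj₂ (x∈p∩q⁻ p q x∈p∩q))

∣p∣≡∣p∩q∣+∣p─q∣ : ∀ (p q : Subset n) → ∣ p ∣ ≡ ∣ p ∩ q ∣ + ∣ p ─ q ∣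
∣p∣≡∣p∩q∣+∣p─q∣ p q = trans (cong ∣_∣ (sym (p∩q∪p─q≡p p q)))
  (∣p∪q∣≡∣p∣+∣q∣ (p ∩ q) (p ─ q) (p∩q-disjoint-p─q p q))

q⊆p⇒p∩q≡q : ∀ (p q : Subset n) → q ⊆ p → p ∩ q ≡ q
q⊆p⇒p∩q≡q p q q⊆p = ⊆-antisym (p∩q⊆q p q) (λ x∈q → x∈p∩q⁺ (q⊆p x∈q , x∈q))

∣p∣≡∣q∣+∣p─q∣ : ∀ (p q : Subset n) → q ⊆ p → ∣ p ∣ ≡ ∣ q ∣ + ∣ p ─ q ∣
∣p∣≡∣q∣+∣p─q∣ p q q⊆p = trans (∣p∣≡∣p∩q∣+∣p─q∣ p q) (cong (λ r → ∣ r ∣ + ∣ p ─ q ∣) (q⊆p⇒p∩q≡q p q q⊆p))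

p⊆q∧∣q∣≤∣p∣⇒q⊆p : p ⊆ q → ∣ q ∣ ≤ ∣ p ∣ → q ⊆ p
p⊆q∧∣q∣≤∣p∣⇒q⊆p {p = p} p⊆q ∣q∣≤∣p∣ {x} x∈q with x ∈? p
... | yes x∈p = x∈p
... | no  x∉p = contradiction ∣q∣≤∣p∣ (<⇒≱ (p⊂q⇒∣p∣<∣q∣ (p⊆q , x , x∈q , x∉p)))

∣p─q∣+∣q∣≤∣p∣⇒q⊆p : ∀ (p q : Subset n) → ∣ p ─ q ∣ + ∣ q ∣ ≤ ∣ p ∣ → q ⊆ p
∣p─q∣+∣q∣≤∣p∣⇒q⊆p p q ≤∣p∣ = p∩q⊆p p q ∘ p⊆q∧∣q∣≤∣p∣⇒q⊆p (p∩q⊆q p q) ∣q∣≤∣p∩q∣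
  where
  ∣q∣≤∣p∩q∣ : ∣ q ∣ ≤ ∣ p ∩ q ∣
  ∣q∣≤∣p∩q∣ = +-cancelˡ-≤ ∣ p ─ q ∣ _ _ (begin
    ∣ p ─ q ∣ + ∣ q ∣      ≤⟨ ≤∣p∣ ⟩
    ∣ p ∣                  ≡⟨ ∣p∣≡∣p∩q∣+∣p─q∣ p q ⟩
    ∣ p ∩ q ∣ + ∣ p ─ q ∣  ≡⟨ +-comm ∣ p ∩ q ∣ _ ⟩
    ∣ p ─ q ∣ + ∣ p ∩ q ∣  ∎)
    where open ≤-Reasoning

∪-lub : ∀ {p q r : Subset n} → p ⊆ r → q ⊆ r → p ∪ q ⊆ r
∪-lub {p = p} {q} p⊆r q⊆r = [ p⊆r , q⊆r ]′ ∘ x∈p∪q⁻ p q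

x∈p⇒⁅x⁆⊆p : x ∈ p → ⁅ x ⁆ ⊆ p
x∈p⇒⁅x⁆⊆p {x = x} {p = p} x∈p y∈⁅x⁆ = subst (_∈ p) (sym (x∈⁅y⁆⇒x≡y x y∈⁅x⁆)) x∈p

p⊆q∪⁅x⁆⇒p─q≡⁅x⁆ : p ⊆ q ∪ ⁅ x ⁆ → x ∈ p → x ∉ q → p ─ q ≡ ⁅ x ⁆
p⊆q∪⁅x⁆⇒p─q≡⁅x⁆ {p = p} {q} {x} p⊆q∪x x∈p x∉q = ⊆-antisym p─q⊆⁅x⁆ (x∈p⇒⁅x⁆⊆p (x∈p∧x∉q⇒x∈p─q x∈p x∉q))
  where
  p─q⊆⁅x⁆ : p ─ q ⊆ ⁅ x ⁆
  p─q⊆⁅x⁆ y∈p─q = [ (λ y∈q → contradiction y∈q (x∈p─q⇒x∉q p q y∈p─q)) , id ]′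
                    (x∈p∪q⁻ q ⁅ x ⁆ (p⊆q∪x (p─q⊆p p q y∈p─q)))

∣p∣≡∣q∣⇒∣p─q∣≡∣q─p∣ : ∀ (p q : Subset n) → ∣ p ∣ ≡ ∣ q ∣ → ∣ p ─ q ∣ ≡ ∣ q ─ p ∣
∣p∣≡∣q∣⇒∣p─q∣≡∣q─p∣ p q ∣p∣≡∣q∣ = +-cancelˡ-≡ ∣ p ∩ q ∣ _ _ (begin
  ∣ p ∩ q ∣ + ∣ p ─ q ∣  ≡⟨ ∣p∣≡∣p∩q∣+∣p─q∣ p q ⟨
  ∣ p ∣                  ≡⟨ ∣p∣≡∣q∣ ⟩
  ∣ q ∣                  ≡⟨ ∣p∣≡∣p∩q∣+∣p─q∣ q p ⟩
  ∣ q ∩ p ∣ + ∣ q ─ p ∣  ≡⟨ cong (λ r → ∣ r ∣ + ∣ q ─ p ∣) (∩-comm q p) ⟩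
  ∣ p ∩ q ∣ + ∣ q ─ p ∣  ∎)
  where open ≡-Reasoning

Empty⇒∣p∣≡0 : ∀ {n} {p : Subset n} → Empty p → ∣ p ∣ ≡ 0
Empty⇒∣p∣≡0 {n} p-empty = trans (cong ∣_∣ (Empty-unique p-empty)) (∣⊥∣≡0 n)

∣p∣≡1⇒p≡⁅x⁆ : ∀ (p : Subset n) → ∣ p ∣ ≡ 1 → ∃ λ x → p ≡ ⁅ x ⁆
∣p∣≡1⇒p≡⁅x⁆ p ∣p∣≡1 with nonempty? p
... | no  p-empty   = contradiction (trans (sym ∣p∣≡1) (Empty⇒∣p∣≡0 p-empty)) λ ()
... | yes (x , x∈p) = x , sym (⊆-antisym ⁅x⁆⊆p (p⊆q∧∣q∣≤∣p∣⇒q⊆p ⁅x⁆⊆p (≤-reflexive (trans ∣p∣≡1 (sym (∣⁅x⁆∣≡1 x))))))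
  where
  ⁅x⁆⊆p : ⁅ x ⁆ ⊆ p
  ⁅x⁆⊆p = x∈p⇒⁅x⁆⊆p x∈p

select : {P : Pred (Fin n) ℓ} → Decidable P → Subset n
select P? = tabulate (does ∘ P?)

module _ {P : Pred (Fin n) ℓ} (P? : Decidable P) where

  ∈-select⁺ : P x → x ∈ select P?
  ∈-select⁺ {x} Px = lookup⇒[]= x _ (trans (lookup∘tabulate (does ∘ P?) x) (dec-true (P? x) Px))

  ∈-select⁻ : x ∈ select P? → P x
  ∈-select⁻ {x} x∈ with P? x | trans (sym (lookup∘tabulate (does ∘ P?) x)) ([]=⇒lookup x∈)
  ... | yes Px | _  = Px
  ... | no  _  | ()

∃<suc⇔ : ∀ {m k} {j : Fin m} {P : Pred (Fin m) ℓ} → toℕ j ≡ k →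
         (∃ λ i → toℕ i < suc k × P i) ⇔ ((∃ λ i → toℕ i < k × P i) ⊎ P j)
∃<suc⇔ {k = k} {j} {P} j≡k = mk⇔ to from
  where
  to : (∃ λ i → toℕ i < suc k × P i) → (∃ λ i → toℕ i < k × P i) ⊎ P j
  to (i , i<1+k , Pi) with m<1+n⇒m<n∨m≡n i<1+k
  ... | inj₁ i<k = inj₁ (i , i<k , Pi)
  ... | inj₂ i≡k = inj₂ (subst P (toℕ-injective (trans i≡k (sym j≡k))) Pi)

  from : (∃ λ i → toℕ i < k × P i) ⊎ P j → ∃ λ i → toℕ i < suc k × P i
  from (inj₁ (i , i<k , Pi)) = i , m<n⇒m<1+n i<k , Pi
  from (inj₂ Pj)             = j , s≤s (≤-reflexive j≡k) , Pj

∈⋃⁺ : ∀ {xs : List (Subset n)} → Any (x ∈_) xs → x ∈ ⋃ xs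
∈⋃⁺ (here x∈p) = x∈p∪q⁺ (inj₁ x∈p)
∈⋃⁺ (there x∈ps) = x∈p∪q⁺ (inj₂ (∈⋃⁺ x∈ps))

∈⋃⁻ : ∀ (xs : List (Subset n)) → x ∈ ⋃ xs → Any (x ∈_) xs
∈⋃⁻ List.[] x∈∅ = contradiction x∈∅ ∉⊥
∈⋃⁻ (p List.∷ ps) x∈ with x∈p∪q⁻ p (⋃ ps) x∈
... | inj₁ x∈p = here x∈p
... | inj₂ x∈ps = there (∈⋃⁻ ps x∈ps)

allSubsets : ∀ n → List (Subset n)
allSubsets zero    = List.[ [] ]
allSubsets (suc n) = List.map (inside ∷_) (allSubsets n) List.++ List.map (outside ∷_) (allSubsets n)

∈-allSubsets : ∀ (p : Subset n) → p ∈ˡ allSubsets n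
∈-allSubsets []            = here refl
∈-allSubsets (inside  ∷ p) = ∈-++⁺ˡ (∈-map⁺ (inside ∷_) (∈-allSubsets p))
∈-allSubsets (outside ∷ p) = ∈-++⁺ʳ (List.map (inside ∷_) (allSubsets _)) (∈-map⁺ (outside ∷_) (∈-allSubsets p))

¬¬-decidable : ∀ (P : Pred (Subset n) ℓ) → ¬ ¬ Decidable P
¬¬-decidable {zero}  P = ¬¬-map (λ P[]? → λ { [] → P[]? }) ¬¬-excluded-middle
¬¬-decidable {suc n} P ¬P? =
  ¬¬-decidable (P ∘ (inside ∷_)) λ Pin? →
  ¬¬-decidable (P ∘ (outside ∷_)) λ Pout? →
  ¬P? λ { (inside ∷ p) → Pin? p ; (outside ∷ p) → Pout? p }

module MatroidProperties {n : ℕ} (M : Matroid n) where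

  open Matroid M

  IsBasis : Subset n → Set
  IsBasis = IsBasisOf Indep

  private
    variable
      A B I : Subset n

  basis-card-max : IsBasis B → Indep A → ∣ A ∣ ≤ ∣ B ∣
  basis-card-max {B} {A} (iB , B-maximal) iA with ∣ A ∣ ≤? ∣ B ∣
  ... | yes ∣A∣≤∣B∣ = ∣A∣≤∣B∣
  ... | no  ∣A∣≰∣B∣ with exchange iB iA (≰⇒> ∣A∣≰∣B∣)
  ... | x , _ , x∉B , iB∪x = contradiction (B-maximal _ iB∪x (p⊆p∪q ⁅ x ⁆) (x∈p∪q⁺ (inj₂ (x∈⁅x⁆ x)))) x∉B

  card-max⇒basis : Indep B → (∀ {A} → Indep A → ∣ A ∣ ≤ ∣ B ∣) → IsBasis B
  card-max⇒basis iB card-max = iB , λ A iA B⊆A → p⊆q∧∣q∣≤∣p∣⇒q⊆p B⊆A (card-max iA)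

  basis-card⇒basis : IsBasis B → Indep A → ∣ B ∣ ≤ ∣ A ∣ → IsBasis A
  basis-card⇒basis bB iA ∣B∣≤∣A∣ = card-max⇒basis iA λ iA′ → ≤-trans (basis-card-max bB iA′) ∣B∣≤∣A∣

  augment : Indep I → Indep B → ∃ λ J → Indep J × I ⊆ J × J ⊆ I ∪ B × ∣ B ∣ ≤ ∣ J ∣
  augment {I} {B} iI iB = go I (⊃-wellFounded I) iI
    where
    go : ∀ I → Acc _⊃_ I → Indep I → ∃ λ J → Indep J × I ⊆ J × J ⊆ I ∪ B × ∣ B ∣ ≤ ∣ J ∣
    go I (acc smaller) iI with ∣ B ∣ ≤? ∣ I ∣
    ... | yes ∣B∣≤∣I∣ = I , iI , id , p⊆p∪q B , ∣B∣≤∣I∣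
    ... | no  ∣B∣≰∣I∣ with exchange iI iB (≰⇒> ∣B∣≰∣I∣)
    ... | x , x∈B , x∉I , iI∪x with go (I ∪ ⁅ x ⁆) (smaller (p⊆p∪q ⁅ x ⁆ , x , q⊆p∪q I ⁅ x ⁆ (x∈⁅x⁆ x) , x∉I)) iI∪x
    ... | J , iJ , I∪x⊆J , J⊆I∪x∪B , ∣B∣≤∣J∣ =
      J , iJ , I∪x⊆J ∘ p⊆p∪q ⁅ x ⁆ , I∪x∪B⊆I∪B ∘ J⊆I∪x∪B , ∣B∣≤∣J∣
      where
      I∪x∪B⊆I∪B : (I ∪ ⁅ x ⁆) ∪ B ⊆ I ∪ B
      I∪x∪B⊆I∪B = ∪-lub (∪-lub (p⊆p∪q B) (q⊆p∪q I B ∘ x∈p⇒⁅x⁆⊆p x∈B)) (q⊆p∪q I B)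

module OrderedAbelianGroupProperties (G : OrderedAbelianGroup) where

  open OrderedAbelianGroup G renaming (_+_ to _⊕_; _≤_ to _≼_; _<_ to _≺_; +-monoˡ-≤ to ⊕-monoˡ-≼)
  open IsAbelianGroup isAbelianGroup using (assoc; comm; identityʳ; inverseʳ; isCommutativeSemigroup)
  open IsTotalOrder isTotalOrder using (antisym)

  private
    variable
      a b c d : Carrier

  totalOrder : TotalOrder 0ℓ 0ℓ 0ℓ
  totalOrder = record { isTotalOrder = isTotalOrder }

  module ≼-Reasoning = Relation.Binary.Reasoning.PartialOrder (TotalOrder.poset totalOrder)

  commutativeSemigroup : CommutativeSemigroup 0ℓ 0ℓ
  commutativeSemigroup = record { isCommutativeSemigroup = isCommutativeSemigroup }

  open Algebra.Properties.CommutativeSemigroup commutativeSemigroup using (interchange)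

  ⊕-cancelʳ-≼ : ∀ c → a ⊕ c ≼ b ⊕ c → a ≼ b
  ⊕-cancelʳ-≼ {a} {b} c = subst₂ _≼_ (x⊕c⊕-c≡x a) (x⊕c⊕-c≡x b) ∘ ⊕-monoˡ-≼ (- c)
    where
    x⊕c⊕-c≡x : ∀ x → x ⊕ c ⊕ - c ≡ x
    x⊕c⊕-c≡x x = trans (assoc x c (- c)) (trans (cong (x ⊕_) (inverseʳ c)) (identityʳ x))

  ⊕-cancelˡ-≼ : ∀ c → c ⊕ a ≼ c ⊕ b → a ≼ b
  ⊕-cancelˡ-≼ {a} {b} c = ⊕-cancelʳ-≼ c ∘ subst₂ _≼_ (comm c a) (comm c b)

  ⊕-monoʳ-≼ : ∀ c → a ≼ b → c ⊕ a ≼ c ⊕ b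
  ⊕-monoʳ-≼ {a} {b} c = subst₂ _≼_ (comm a c) (comm b c) ∘ ⊕-monoˡ-≼ c

  ≺⇒⋡ : a ≺ b → ¬ (b ≼ a)
  ≺⇒⋡ (a≼b , a≢b) b≼a = a≢b (antisym a≼b b≼a)

  ≺-irrefl : ¬ (a ≺ a)
  ≺-irrefl (_ , a≢a) = a≢a refl

  [a⊕b]⊕[c⊕d]≡[a⊕d]⊕[c⊕b] : ∀ a b c d → (a ⊕ b) ⊕ (c ⊕ d) ≡ (a ⊕ d) ⊕ (c ⊕ b)
  [a⊕b]⊕[c⊕d]≡[a⊕d]⊕[c⊕b] a b c d = begin
    (a ⊕ b) ⊕ (c ⊕ d)  ≡⟨ cong ((a ⊕ b) ⊕_) (comm c d) ⟩
    (a ⊕ b) ⊕ (d ⊕ c)  ≡⟨ interchange a b d c ⟩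
    (a ⊕ d) ⊕ (b ⊕ c)  ≡⟨ cong ((a ⊕ d) ⊕_) (comm b c) ⟩
    (a ⊕ d) ⊕ (c ⊕ b)  ∎
    where open ≡-Reasoning

  a⊕b≡c⊕d∧d≼b⇒a≼c : a ⊕ b ≡ c ⊕ d → d ≼ b → a ≼ c
  a⊕b≡c⊕d∧d≼b⇒a≼c {a} {d = d} a⊕b≡c⊕d d≼b = ⊕-cancelʳ-≼ d (subst (a ⊕ d ≼_) a⊕b≡c⊕d (⊕-monoʳ-≼ a d≼b))

module WeightedProperties (G : OrderedAbelianGroup) {n : ℕ} (M : Matroid n)
                          (w : Fin n → OrderedAbelianGroup.Carrier G) where

  open OrderedAbelianGroup G renaming (_+_ to _⊕_; _≤_ to _≼_; _<_ to _≺_)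
  open IsAbelianGroup isAbelianGroup using (assoc; comm; identityʳ)
  open IsTotalOrder isTotalOrder using () renaming (refl to ≼-refl)
  open OrderedAbelianGroupProperties G
  open Algebra.Properties.CommutativeSemigroup commutativeSemigroup using (x∙yz≈y∙xz)
  open Matroid M
  open MatroidProperties M
  open Weighted G M w hiding (IsBasis)
  module W-Extrema = Data.List.Extrema totalOrder

  private
    variable
      A B I J L : Subset n

  sumOver-∅ : ∀ {m} (f : Fin m → Carrier) → sumOver f ∅ ≡ 0#
  sumOver-∅ {zero}  f = refl
  sumOver-∅ {suc m} f = sumOver-∅ (f ∘ suc)

  sumOver-⁅⁆ : ∀ {m} (f : Fin m → Carrier) y → sumOver f ⁅ y ⁆ ≡ f y
  sumOver-⁅⁆ f zero    = trans (cong (f zero ⊕_) (sumOver-∅ (f ∘ suc))) (identityʳ (f zero))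
  sumOver-⁅⁆ f (suc y) = sumOver-⁅⁆ (f ∘ suc) y

  sumOver-∪ : ∀ {m} (f : Fin m → Carrier) (p q : Subset m) → Disjoint p q →
              sumOver f (p ∪ q) ≡ sumOver f p ⊕ sumOver f q
  sumOver-∪ f []            []            _ = sym (identityʳ 0#)
  sumOver-∪ f (inside  ∷ p) (inside  ∷ q) d = contradiction here (d here)
  sumOver-∪ f (inside  ∷ p) (outside ∷ q) d =
    trans (cong (f zero ⊕_) (sumOver-∪ (f ∘ suc) p q (λ x∈p → d (there x∈p) ∘ there))) (sym (assoc _ _ _))
  sumOver-∪ f (outside ∷ p) (inside  ∷ q) d =
    trans (cong (f zero ⊕_) (sumOver-∪ (f ∘ suc) p q (λ x∈p → d (there x∈p) ∘ there))) (x∙yz≈y∙xz _ _ _)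
  sumOver-∪ f (outside ∷ p) (outside ∷ q) d = sumOver-∪ (f ∘ suc) p q (λ x∈p → d (there x∈p) ∘ there)

  weight-∪ : ∀ (p q : Subset n) → Disjoint p q → weight (p ∪ q) ≡ weight p ⊕ weight q
  weight-∪ = sumOver-∪ w

  weight-∩─ : ∀ (p q : Subset n) → weight p ≡ weight (p ∩ q) ⊕ weight (p ─ q)
  weight-∩─ p q = trans (cong weight (sym (p∩q∪p─q≡p p q))) (weight-∪ (p ∩ q) (p ─ q) (p∩q-disjoint-p─q p q))

  weight-⊆─ : ∀ (p q : Subset n) → q ⊆ p → weight p ≡ weight q ⊕ weight (p ─ q)
  weight-⊆─ p q q⊆p = trans (weight-∩─ p q) (cong (λ r → weight r ⊕ weight (p ─ q)) (q⊆p⇒p∩q≡q p q q⊆p))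

  minBasis-exchange : IsMinBasis B → IsBasis J → J ⊆ B ∪ ⁅ x ⁆ → x ∈ J → x ∉ B →
                      ∃ λ y → y ∈ B × y ∉ J × w y ≼ w x
  minBasis-exchange {B} {J} {x} (bB , B-min) bJ J⊆B∪x x∈J x∉B =
    let y , B─J≡⁅y⁆ = ∣p∣≡1⇒p≡⁅x⁆ (B ─ J) ∣B─J∣≡1
        y∈B─J       = subst (y ∈_) (sym B─J≡⁅y⁆) (x∈⁅x⁆ y)
    in y , p─q⊆p B J y∈B─J , x∈p─q⇒x∉q B J y∈B─J , lighter B─J≡⁅y⁆
    where
    J─B≡⁅x⁆ : J ─ B ≡ ⁅ x ⁆
    J─B≡⁅x⁆ = p⊆q∪⁅x⁆⇒p─q≡⁅x⁆ J⊆B∪x x∈J x∉B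

    ∣B─J∣≡1 : ∣ B ─ J ∣ ≡ 1
    ∣B─J∣≡1 = begin
      ∣ B ─ J ∣  ≡⟨ ∣p∣≡∣q∣⇒∣p─q∣≡∣q─p∣ J B (≤-antisym (basis-card-max bB (proj₁ bJ)) (basis-card-max bJ (proj₁ bB))) ⟨
      ∣ J ─ B ∣  ≡⟨ cong ∣_∣ J─B≡⁅x⁆ ⟩
      ∣ ⁅ x ⁆ ∣  ≡⟨ ∣⁅x⁆∣≡1 x ⟩
      1          ∎
      where open ≡-Reasoning

    lighter : ∀ {y} → B ─ J ≡ ⁅ y ⁆ → w y ≼ w x
    lighter {y} B─J≡⁅y⁆ = ⊕-cancelˡ-≼ (weight (B ∩ J)) (begin
      weight (B ∩ J) ⊕ w y              ≡⟨ cong (weight (B ∩ J) ⊕_) (trans (cong weight B─J≡⁅y⁆) (sumOver-⁅⁆ w y)) ⟨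
      weight (B ∩ J) ⊕ weight (B ─ J)   ≡⟨ weight-∩─ B J ⟨
      weight B                           ≤⟨ B-min J bJ ⟩
      weight J                           ≡⟨ weight-∩─ J B ⟩
      weight (J ∩ B) ⊕ weight (J ─ B)   ≡⟨ cong₂ _⊕_ (cong weight (∩-comm J B)) (trans (cong weight J─B≡⁅x⁆) (sumOver-⁅⁆ w x)) ⟩
      weight (B ∩ J) ⊕ w x              ∎)
      where open ≼-Reasoning

  -- Augmenting L ∪ {x} from B gives a basis B - y + x with y ∉ L, and it would be lighter than B.
  no-lighter-extension : IsMinBasis B → L ⊆ B → x ∉ L → Indep (L ∪ ⁅ x ⁆) →
                         ¬ (∀ {y} → y ∈ B → y ∉ L → w x ≺ w y)
  no-lighter-extension {B} {L} {x} mB@(bB , _) L⊆B x∉L iL∪x x-lighter with augment iL∪x (proj₁ bB)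
  ... | J , iJ , L∪x⊆J , J⊆L∪x∪B , ∣B∣≤∣J∣ =
    let y , y∈B , y∉J , wy≼wx = minBasis-exchange mB (basis-card⇒basis bB iJ ∣B∣≤∣J∣)
                                  (L∪x∪B⊆B∪x ∘ J⊆L∪x∪B) (L∪x⊆J (q⊆p∪q L ⁅ x ⁆ (x∈⁅x⁆ x))) x∉B
    in ≺⇒⋡ (x-lighter y∈B (y∉J ∘ L∪x⊆J ∘ p⊆p∪q ⁅ x ⁆)) wy≼wx
    where
    x∉B : x ∉ B
    x∉B x∈B = ≺-irrefl (x-lighter x∈B x∉L)

    L∪x∪B⊆B∪x : (L ∪ ⁅ x ⁆) ∪ B ⊆ B ∪ ⁅ x ⁆
    L∪x∪B⊆B∪x = ∪-lub (∪-lub (p⊆p∪q ⁅ x ⁆ ∘ L⊆B) (q⊆p∪q B ⁅ x ⁆)) (p⊆p∪q ⁅ x ⁆)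

  ∣lighter∣≤∣part∣ : IsMinBasis B → L ⊆ B → Indep I →
                     (∀ {x y} → x ∈ I → y ∈ B → y ∉ L → w x ≺ w y) → ∣ I ∣ ≤ ∣ L ∣
  ∣lighter∣≤∣part∣ {B} {L} {I} mB@(bB , _) L⊆B iI lighter with ∣ I ∣ ≤? ∣ L ∣
  ... | yes ∣I∣≤∣L∣ = ∣I∣≤∣L∣
  ... | no  ∣I∣≰∣L∣ with exchange (indep-⊆ L⊆B (proj₁ bB)) iI (≰⇒> ∣I∣≰∣L∣)
  ... | x , x∈I , x∉L , iL∪x = contradiction (λ {_} → lighter x∈I) (no-lighter-extension mB L⊆B x∉L iL∪x)

  module _ (indep? : Decidable Indep) where

    independentSets : List (Subset n)
    independentSets = List.filter indep? (allSubsets n)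

    ∈-independentSets : Indep A → A ∈ˡ independentSets
    ∈-independentSets {A} = ∈-filter⁺ indep? (∈-allSubsets A)

    largestIndep : Subset n
    largestIndep = ℕ-Extrema.argmax ∣_∣ ∅ independentSets

    largestIndep-isBasis : IsBasis largestIndep
    largestIndep-isBasis = card-max⇒basis
      (ℕ-Extrema.argmax-all ∣_∣ indep-∅ (all-filter indep? (allSubsets n)))
      (λ iA → All.lookup (ℕ-Extrema.f[xs]≤f[argmax] ∅ independentSets) (∈-independentSets iA))

    sameSize? : Decidable (λ A → Indep A × ∣ A ∣ ≡ ∣ largestIndep ∣)
    sameSize? A = indep? A ×-dec (∣ A ∣ ≟ ∣ largestIndep ∣)

    bases : List (Subset n)
    bases = List.filter sameSize? (allSubsets n)

    lightestBasis : Subset n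
    lightestBasis = W-Extrema.argmin weight largestIndep bases

    lightestBasis-isMinBasis : IsMinBasis lightestBasis
    lightestBasis-isMinBasis = basis-card⇒basis largestIndep-isBasis (proj₁ sized) (≤-reflexive (sym (proj₂ sized))) ,
      λ B bB → All.lookup (W-Extrema.f[argmin]≤f[xs] largestIndep bases)
                          (∈-filter⁺ sameSize? (∈-allSubsets B) (proj₁ bB , same-size bB))
      where
      sized : Indep lightestBasis × ∣ lightestBasis ∣ ≡ ∣ largestIndep ∣
      sized = W-Extrema.argmin-all weight (proj₁ largestIndep-isBasis , refl) (all-filter sameSize? (allSubsets n))
      same-size : IsBasis B → ∣ B ∣ ≡ ∣ largestIndep ∣
      same-size bB = ≤-antisym (basis-card-max largestIndep-isBasis (proj₁ bB)) (basis-card-max bB (proj₁ largestIndep-isBasis))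

  -- Indep is not assumed decidable, so existence holds only up to double negation; this is all
  -- ∅-isMinBasis needs.
  minBasis-exists : ¬ ¬ ∃ IsMinBasis
  minBasis-exists = ¬¬-map (λ indep? → lightestBasis indep? , lightestBasis-isMinBasis indep?) (¬¬-decidable Indep)

  ∅-isMinBasis : (∀ {B} → IsMinBasis B → Empty B) → IsMinBasis ∅
  ∅-isMinBasis minBases-empty = (indep-∅ , λ A iA _ x∈A → contradiction (_ , x∈A) (indep-empty iA)) ,
    λ B bB → subst (λ B → weight ∅ ≼ weight B) (sym (Empty-unique (indep-empty (proj₁ bB)))) ≼-refl
    where
    indep-empty : Indep A → Empty A
    indep-empty {A} iA (x , x∈A) = minBasis-exists λ (B , mB) →
      <⇒≱ (≤-<-trans z≤n (x∈p⇒∣p-x∣<∣p∣ x∈A))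
          (subst (∣ A ∣ ≤_) (Empty⇒∣p∣≡0 (minBases-empty mB)) (basis-card-max (proj₁ mB) iA))

  minBasis-from-weights : ∀ β (ω : Fin β → Carrier) → DistinctMinWeights β ω → ∃ IsMinBasis
  minBasis-from-weights zero    ω (_ , weights-listed , _) =
    ∅ , ∅-isMinBasis λ mB (x , x∈B) → ¬Fin0 (proj₁ (weights-listed _ (_ , mB , x , x∈B , refl)))
  minBasis-from-weights (suc β) ω (weights-attained , _) =
    let B , mB , _ = weights-attained zero in B , mB

module Levels (G : OrderedAbelianGroup) {n : ℕ} (M : Matroid n)
              (w : Fin n → OrderedAbelianGroup.Carrier G)
              (β : ℕ) (ω : Fin β → OrderedAbelianGroup.Carrier G)
              (dmw : Weighted.DistinctMinWeights G M w β ω) where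

  open OrderedAbelianGroup G using (isTotalOrder) renaming (_+_ to _⊕_; _≤_ to _≼_; _<_ to _≺_)
  open IsTotalOrder isTotalOrder using () renaming (trans to ≼-trans)
  open OrderedAbelianGroupProperties G
  open Matroid M
  open MatroidProperties M
  open Weighted G M w hiding (IsBasis)
  open WeightedProperties G M w

  private
    variable
      B C D S : Subset n
      i j : Fin β
      k : ℕ
      e e′ : Fin n

  ω-strictMono : toℕ i < toℕ j → ω i ≺ ω j
  ω-strictMono = proj₂ (proj₂ dmw) _ _

  ω-injective : ω i ≡ ω j → i ≡ j
  ω-injective {i} {j} ωi≡ωj with <-cmp i j
  ... | tri< i<j _ _ = contradiction ωi≡ωj (proj₂ (ω-strictMono i<j))
  ... | tri≈ _ i≡j _ = i≡j
  ... | tri> _ _ j<i = contradiction (sym ωi≡ωj) (proj₂ (ω-strictMono j<i))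

  minBasis-level : IsMinBasis B → e ∈ B → ∃ λ j → w e ≡ ω j
  minBasis-level {B} {e} mB e∈B =
    let j , ωj≡we = proj₁ (proj₂ dmw) (w e) (B , mB , e , e∈B , refl) in j , sym ωj≡we

  Below : ℕ → Pred (Fin n) 0ℓ
  Below k e = ∃ λ j → toℕ j < k × w e ≡ ω j

  Below-level : Below k e → w e ≡ ω j → toℕ j < k
  Below-level {k} (i , i<k , we≡ωi) we≡ωj = subst (λ j → toℕ j < k) (ω-injective (trans (sym we≡ωi) we≡ωj)) i<k

  Below-lighter : Below k e → w e′ ≡ ω j → k ≤ toℕ j → w e ≺ w e′
  Below-lighter (i , i<k , we≡ωi) we′≡ωj k≤j = subst₂ _≺_ (sym we≡ωi) (sym we′≡ωj) (ω-strictMono (<-≤-trans i<k k≤j))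

  Below-suc⁻ : toℕ j ≡ k → Below (suc k) e → Below k e ⊎ w e ≡ ω j
  Below-suc⁻ j≡k = Equivalence.to (∃<suc⇔ j≡k)

  -- below mB k is B_{<k} = {e ∈ B : w e < ω_k}.  Equality of weights is not decidable, so weights
  -- are compared through their indices; each element of a minimum basis has exactly one.
  below? : IsMinBasis B → ∀ k → Decidable (λ e → e ∈ B × Below k e)
  below? {B} mB k e with e ∈? B
  ... | no  e∉B = no (e∉B ∘ proj₁)
  ... | yes e∈B = let j , we≡ωj = minBasis-level mB e∈B in
    Dec.map′ (λ j<k → e∈B , j , j<k , we≡ωj) (λ (_ , below-k) → Below-level below-k we≡ωj) (toℕ j <? k)

  below : IsMinBasis B → ℕ → Subset n
  below mB k = select (below? mB k)

  module _ (mB : IsMinBasis B) where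

    ∈-below⁺ : e ∈ B → Below k e → e ∈ below mB k
    ∈-below⁺ e∈B below-k = ∈-select⁺ (below? mB _) (e∈B , below-k)

    ∈-below⁻ : e ∈ below mB k → e ∈ B × Below k e
    ∈-below⁻ = ∈-select⁻ (below? mB _)

    below⊆ : below mB k ⊆ B
    below⊆ = proj₁ ∘ ∈-below⁻

    below⊆below-suc : below mB k ⊆ below mB (suc k)
    below⊆below-suc e∈ = let e∈B , j , j<k , we≡ωj = ∈-below⁻ e∈ in ∈-below⁺ e∈B (j , m<n⇒m<1+n j<k , we≡ωj)

    ∉below⇒¬Below : e ∈ B → e ∉ below mB k → ¬ Below k e
    ∉below⇒¬Below e∈B e∉ = e∉ ∘ ∈-below⁺ e∈B

    ∉below : w e ≡ ω j → k ≤ toℕ j → e ∉ below mB k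
    ∉below we≡ωj k≤j e∈below = <⇒≱ (Below-level (proj₂ (∈-below⁻ e∈below)) we≡ωj) k≤j

    Below-lighter-than-rest : Below k e → e′ ∈ B → e′ ∉ below mB k → w e ≺ w e′
    Below-lighter-than-rest below-k e′∈B e′∉ = let j , we′≡ωj = minBasis-level mB e′∈B in
      Below-lighter below-k we′≡ωj (≮⇒≥ λ j<k → ∉below⇒¬Below e′∈B e′∉ (j , j<k , we′≡ωj))

    ∣Below∣≤∣below∣ : ∀ {I} → Indep I → (∀ {e} → e ∈ I → Below k e) → ∣ I ∣ ≤ ∣ below mB k ∣
    ∣Below∣≤∣below∣ iI I-below = ∣lighter∣≤∣part∣ mB below⊆ iI (Below-lighter-than-rest ∘ I-below)

  ∣below∣≡∣below∣ : (mB : IsMinBasis B) (mC : IsMinBasis C) → ∀ k → ∣ below mB k ∣ ≡ ∣ below mC k ∣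
  ∣below∣≡∣below∣ mB mC k = ≤-antisym (∣Below∣≤∣below∣ mC (below-indep mB) (proj₂ ∘ ∈-below⁻ mB))
                                      (∣Below∣≤∣below∣ mB (below-indep mC) (proj₂ ∘ ∈-below⁻ mC))
    where
    below-indep : (mB : IsMinBasis B) → Indep (below mB k)
    below-indep mB = indep-⊆ (below⊆ mB) (proj₁ (proj₁ mB))

  module _ (mD : IsMinBasis D) (mC : IsMinBasis C) (k : ℕ) where

    below-disjoint-above : Disjoint (below mD k) (C ─ below mC k)
    below-disjoint-above e∈D< e∈C≥ =
      ∉below⇒¬Below mC (p─q⊆p C _ e∈C≥) (x∈p─q⇒x∉q C _ e∈C≥) (proj₂ (∈-below⁻ mD e∈D<))

    -- Augment D_{<k} from C to J.  The part of J outside C_{≥k} lies below ω_k, so it is no larger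
    -- than D_{<k}, which has the size of C_{<k}; this forces C_{≥k} ⊆ J.
    swap-isBasis : IsBasis (below mD k ∪ (C ─ below mC k))
    swap-isBasis with augment (indep-⊆ (below⊆ mD) (proj₁ (proj₁ mD))) (proj₁ (proj₁ mC))
    ... | J , iJ , D<⊆J , J⊆D<∪C , ∣C∣≤∣J∣ = basis-card⇒basis (proj₁ mC) (indep-⊆ (∪-lub D<⊆J C≥⊆J) iJ) ∣C∣≤∣E∣
      where
      D< = below mD k
      C< = below mC k
      C≥ = C ─ C<

      J─C≥-below : ∀ {e} → e ∈ J ─ C≥ → Below k e
      J─C≥-below {e} e∈J─C≥ with x∈p∪q⁻ D< C (J⊆D<∪C (p─q⊆p J C≥ e∈J─C≥)) | e ∈? C<
      ... | inj₁ e∈D< | _       = proj₂ (∈-below⁻ mD e∈D<)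
      ... | inj₂ _    | yes e∈C< = proj₂ (∈-below⁻ mC e∈C<)
      ... | inj₂ e∈C  | no  e∉C< = contradiction (x∈p∧x∉q⇒x∈p─q e∈C e∉C<) (x∈p─q⇒x∉q J C≥ e∈J─C≥)

      ∣C∣≡∣D<∣+∣C≥∣ : ∣ C ∣ ≡ ∣ D< ∣ + ∣ C≥ ∣
      ∣C∣≡∣D<∣+∣C≥∣ = trans (∣p∣≡∣q∣+∣p─q∣ C C< (below⊆ mC)) (cong (_+ ∣ C≥ ∣) (∣below∣≡∣below∣ mC mD k))

      C≥⊆J : C≥ ⊆ J
      C≥⊆J = ∣p─q∣+∣q∣≤∣p∣⇒q⊆p J C≥ (begin
        ∣ J ─ C≥ ∣ + ∣ C≥ ∣  ≤⟨ +-monoˡ-≤ ∣ C≥ ∣ (∣Below∣≤∣below∣ mD (indep-⊆ (p─q⊆p J C≥) iJ) J─C≥-below) ⟩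
        ∣ D< ∣ + ∣ C≥ ∣      ≡⟨ ∣C∣≡∣D<∣+∣C≥∣ ⟨
        ∣ C ∣                ≤⟨ ∣C∣≤∣J∣ ⟩
        ∣ J ∣                ∎)
        where open ≤-Reasoning

      ∣C∣≤∣E∣ : ∣ C ∣ ≤ ∣ D< ∪ C≥ ∣
      ∣C∣≤∣E∣ = ≤-reflexive (trans ∣C∣≡∣D<∣+∣C≥∣ (sym (∣p∪q∣≡∣p∣+∣q∣ D< C≥ below-disjoint-above)))

  swap-isMinBasis : (mD : IsMinBasis D) (mC : IsMinBasis C) (k : ℕ) → IsMinBasis (below mD k ∪ (C ─ below mC k))
  swap-isMinBasis {D} {C} mD mC k = swap-isBasis mD mC k , λ B bB → ≼-trans wE≼wD (proj₂ mD B bB)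
    where
    wE≼wD : weight (below mD k ∪ (C ─ below mC k)) ≼ weight D
    wE≼wD = a⊕b≡c⊕d∧d≼b⇒a≼c (begin
      weight (below mD k ∪ (C ─ below mC k)) ⊕ weight (below mC k ∪ (D ─ below mD k))
        ≡⟨ cong₂ _⊕_ (weight-∪ _ _ (below-disjoint-above mD mC k)) (weight-∪ _ _ (below-disjoint-above mC mD k)) ⟩
      (weight (below mD k) ⊕ weight (C ─ below mC k)) ⊕ (weight (below mC k) ⊕ weight (D ─ below mD k))
        ≡⟨ [a⊕b]⊕[c⊕d]≡[a⊕d]⊕[c⊕b] _ _ _ _ ⟩
      (weight (below mD k) ⊕ weight (D ─ below mD k)) ⊕ (weight (below mC k) ⊕ weight (C ─ below mC k))
        ≡⟨ cong₂ _⊕_ (weight-⊆─ D _ (below⊆ mD)) (weight-⊆─ C _ (below⊆ mC)) ⟨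
      weight D ⊕ weight C ∎)
      (proj₂ mC _ (swap-isBasis mC mD k))
      where open ≡-Reasoning

  -- layer mB j = B ∩ U*_j
  layer : IsMinBasis B → Fin β → Subset n
  layer mB j = below mB (suc (toℕ j)) ─ below mB (toℕ j)

  module _ (mB : IsMinBasis B) where

    ∈-layer⁺ : e ∈ B → w e ≡ ω j → e ∈ layer mB j
    ∈-layer⁺ {j = j} e∈B we≡ωj = x∈p∧x∉q⇒x∈p─q (∈-below⁺ mB e∈B (j , ≤-refl , we≡ωj)) (∉below mB we≡ωj ≤-refl)

    ∈-layer⁻ : e ∈ layer mB j → e ∈ B × w e ≡ ω j
    ∈-layer⁻ e∈layer with ∈-below⁻ mB (p─q⊆p _ _ e∈layer)
    ... | e∈B , below-suc with Below-suc⁻ refl below-suc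
    ...   | inj₁ below-j = contradiction (∈-below⁺ mB e∈B below-j) (x∈p─q⇒x∉q _ _ e∈layer)
    ...   | inj₂ we≡ωj  = e∈B , we≡ωj

    layer-isIndep* : Indep*[ ω j ] (layer mB j)
    layer-isIndep* = (λ e e∈layer → let e∈B , we≡ωj = ∈-layer⁻ e∈layer in (B , mB , e∈B) , we≡ωj)
                   , B , mB , proj₁ ∘ ∈-layer⁻

  ∣layer∣≡∣layer∣ : (mB : IsMinBasis B) (mC : IsMinBasis C) → ∀ j → ∣ layer mB j ∣ ≡ ∣ layer mC j ∣
  ∣layer∣≡∣layer∣ mB mC j = +-cancelˡ-≡ ∣ below mB (toℕ j) ∣ _ _ (begin
    ∣ below mB (toℕ j) ∣ + ∣ layer mB j ∣        ≡⟨ ∣p∣≡∣q∣+∣p─q∣ _ _ (below⊆below-suc mB) ⟨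
    ∣ below mB (suc (toℕ j)) ∣                   ≡⟨ ∣below∣≡∣below∣ mB mC (suc (toℕ j)) ⟩
    ∣ below mC (suc (toℕ j)) ∣                   ≡⟨ ∣p∣≡∣q∣+∣p─q∣ _ _ (below⊆below-suc mC) ⟩
    ∣ below mC (toℕ j) ∣ + ∣ layer mC j ∣        ≡⟨ cong (_+ ∣ layer mC j ∣) (∣below∣≡∣below∣ mC mB (toℕ j)) ⟩
    ∣ below mB (toℕ j) ∣ + ∣ layer mC j ∣        ∎)
    where open ≡-Reasoning

  minBasis∩U*-isBasis* : IsMinBasis B → ∀ j S →
    (∀ e → (e ∈ S → e ∈ B × InU*[ ω j ] e) × (e ∈ B × InU*[ ω j ] e → e ∈ S)) →
    IsBasisOf Indep*[ ω j ] S
  minBasis∩U*-isBasis* {B} mB j S S≡B∩U* = ((λ e → proj₂ ∘ S⊆B∩U*) , B , mB , proj₁ ∘ S⊆B∩U*) , S-maximal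
    where
    S⊆B∩U* : ∀ {e} → e ∈ S → e ∈ B × InU*[ ω j ] e
    S⊆B∩U* = proj₁ (S≡B∩U* _)

    layer⊆S : layer mB j ⊆ S
    layer⊆S e∈layer = let e∈B , we≡ωj = ∈-layer⁻ mB e∈layer in proj₂ (S≡B∩U* _) (e∈B , (B , mB , e∈B) , we≡ωj)

    S-maximal : ∀ A → Indep*[ ω j ] A → S ⊆ A → A ⊆ S
    S-maximal A (A⊆U* , C , mC , A⊆C) S⊆A = p⊆q∧∣q∣≤∣p∣⇒q⊆p S⊆A (begin
      ∣ A ∣           ≤⟨ p⊆q⇒∣p∣≤∣q∣ (λ e∈A → ∈-layer⁺ mC (A⊆C e∈A) (proj₂ (A⊆U* _ e∈A))) ⟩
      ∣ layer mC j ∣  ≡⟨ ∣layer∣≡∣layer∣ mC mB j ⟩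
      ∣ layer mB j ∣  ≤⟨ p⊆q⇒∣p∣≤∣q∣ layer⊆S ⟩
      ∣ S ∣           ∎)
      where open ≤-Reasoning

  basis*-is-layer : IsBasisOf Indep*[ ω j ] S → ∃ λ C → Σ (IsMinBasis C) λ mC → S ≡ layer mC j
  basis*-is-layer {j} {S} ((S⊆U* , C , mC , S⊆C) , S-maximal) =
    C , mC , ⊆-antisym S⊆layer (S-maximal _ (layer-isIndep* mC) S⊆layer)
    where
    S⊆layer : S ⊆ layer mC j
    S⊆layer e∈S = ∈-layer⁺ mC (S⊆C e∈S) (proj₂ (S⊆U* _ e∈S))

  swap-Below-suc : (mD : IsMinBasis D) (mC : IsMinBasis C) → toℕ j ≡ k →
                   (e ∈ below mD k ∪ (C ─ below mC k) × Below (suc k) e) ⇔ ((e ∈ D × Below k e) ⊎ e ∈ layer mC j)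
  swap-Below-suc {D} {C} {j} {k} {e} mD mC j≡k = mk⇔ to from
    where
    to : e ∈ below mD k ∪ (C ─ below mC k) × Below (suc k) e → (e ∈ D × Below k e) ⊎ e ∈ layer mC j
    to (e∈E , below-suc) with x∈p∪q⁻ (below mD k) _ e∈E | Below-suc⁻ j≡k below-suc
    ... | inj₁ e∈D< | _ = inj₁ (∈-below⁻ mD e∈D<)
    ... | inj₂ e∈C≥ | inj₁ below-k = contradiction below-k (∉below⇒¬Below mC (p─q⊆p C _ e∈C≥) (x∈p─q⇒x∉q C _ e∈C≥))
    ... | inj₂ e∈C≥ | inj₂ we≡ωj = inj₂ (∈-layer⁺ mC (p─q⊆p C _ e∈C≥) we≡ωj)

    from : (e ∈ D × Below k e) ⊎ e ∈ layer mC j → e ∈ below mD k ∪ (C ─ below mC k) × Below (suc k) e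
    from (inj₁ (e∈D , i , i<k , we≡ωi)) = x∈p∪q⁺ (inj₁ (∈-below⁺ mD e∈D (i , i<k , we≡ωi))) , i , m<n⇒m<1+n i<k , we≡ωi
    from (inj₂ e∈layer) =
      let e∈C , we≡ωj = ∈-layer⁻ mC e∈layer
      in x∈p∪q⁺ (inj₂ (x∈p∧x∉q⇒x∈p─q e∈C (∉below mC we≡ωj (≤-reflexive (sym j≡k))))) , j , s≤s (≤-reflexive j≡k) , we≡ωj

  module _ (B* : Fin β → Subset n) (B*-isBasis* : ∀ j → IsBasisOf Indep*[ ω j ] (B* j)) where

    -- Agrees k D : D_{<k} = ⋃_{j<k} B*_j, with levels numbered from 0.
    Agrees : ℕ → Subset n → Set
    Agrees k D = ∀ e → (e ∈ D × Below k e) ⇔ (∃ λ j → toℕ j < k × e ∈ B* j)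

    agrees-suc : toℕ j ≡ k → IsMinBasis D → Agrees k D → ∃ λ E → IsMinBasis E × Agrees (suc k) E
    agrees-suc {j} {k} {D} j≡k mD agrees with basis*-is-layer (B*-isBasis* j)
    ... | C , mC , B*j≡layer = below mD k ∪ (C ─ below mC k) , swap-isMinBasis mD mC k , λ e → begin
      (e ∈ below mD k ∪ (C ─ below mC k) × Below (suc k) e)  ≈⟨ swap-Below-suc mD mC j≡k ⟩
      ((e ∈ D × Below k e) ⊎ e ∈ layer mC j)                 ≡⟨ cong (λ X → (e ∈ D × Below k e) ⊎ e ∈ X) (sym B*j≡layer) ⟩
      ((e ∈ D × Below k e) ⊎ e ∈ B* j)                       ≈⟨ agrees e ⊎-⇔ ⇔-id _ ⟩
      ((∃ λ i → toℕ i < k × e ∈ B* i) ⊎ e ∈ B* j)            ≈⟨ ∃<suc⇔ j≡k ⟨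
      (∃ λ i → toℕ i < suc k × e ∈ B* i)                     ∎
      where open SetoidReasoning (⇔-setoid 0ℓ)

    agreeing : ∃ IsMinBasis → ∀ k → k ≤ β → ∃ λ D → IsMinBasis D × Agrees k D
    agreeing (D , mD) zero    _   = D , mD , λ e → mk⇔ (λ { (_ , _ , () , _) }) (λ { (_ , () , _) })
    agreeing D₀       (suc k) k<β =
      let D , mD , agrees = agreeing D₀ k (<⇒≤ k<β) in agrees-suc (toℕ-fromℕ< k<β) mD agrees

    ⋃-isMinBasis : IsMinBasis ⋃[ B* ]
    ⋃-isMinBasis =
      let D , mD , agrees = agreeing (minBasis-from-weights β ω dmw) β ≤-refl in
      subst IsMinBasis (⊆-antisym (D⊆⋃ mD agrees) (⋃⊆D agrees)) mD
      where
      D⊆⋃ : IsMinBasis D → Agrees β D → D ⊆ ⋃[ B* ]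
      D⊆⋃ mD agrees e∈D =
        let j , we≡ωj = minBasis-level mD e∈D
            i , _ , e∈B*i = Equivalence.to (agrees _) (e∈D , j , toℕ<n j , we≡ωj)
        in ∈⋃⁺ (Any.tabulate⁺ i e∈B*i)

      ⋃⊆D : Agrees β D → ⋃[ B* ] ⊆ D
      ⋃⊆D agrees e∈⋃ =
        let i , e∈B*i = Any.tabulate⁻ (∈⋃⁻ _ e∈⋃) in proj₁ (Equivalence.from (agrees _) (i , toℕ<n i , e∈B*i))

lemma6 : (G : OrderedAbelianGroup) (n : ℕ) (M : Matroid n)
         (w : Fin n → OrderedAbelianGroup.Carrier G)
         (β : ℕ) (ω : Fin β → OrderedAbelianGroup.Carrier G) →
         Weighted.DistinctMinWeights G M w β ω →
         ((B* : Fin β → Subset n) →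
            (∀ j → IsBasisOf (Weighted.Indep*[_] G M w (ω j)) (B* j)) →
            Weighted.IsMinBasis G M w ⋃[ B* ])
         ×
         ((B : Subset n) → Weighted.IsMinBasis G M w B →
            (j : Fin β) (S : Subset n) →
            -- S = B ∩ U*_j
            (∀ e → (e ∈ S → e ∈ B × Weighted.InU*[_] G M w (ω j) e) ×
                   (e ∈ B × Weighted.InU*[_] G M w (ω j) e → e ∈ S)) →
            IsBasisOf (Weighted.Indep*[_] G M w (ω j)) S)
lemma6 G n M w β ω dmw = ⋃-isMinBasis , λ B mB → minBasis∩U*-isBasis* mB
  where open Levels G M w β ω dmw
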